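{- For any finite simple graph $G$ and any Roman graph $H$, (i) $\gamma_R(G\Box H)\ge \frac{4}{3}\gamma(G)\gamma(H)$, and (ii) $\gamma(G\Box H)\ge \frac{2}{3}\gamma(G)\gamma(H)$.
   Context: $\gamma(X)$ denotes the domination number of a graph $X$ (minimum size of a set $D$ such that every vertex outside $D$ has a neighbor in $D$). A Roman dominating function on $X$ is a map $f:V(X)\to\{0,1,2\}$ such that every vertex $v$ with $f(v)=0$ has a neighbor $u$ with $f(u)=2$; $\gamma_R(X)$ is the minimum of $\sum_v f(v)$ over such $f$. A graph $H$ is a Roman graph if $\gamma_R(H)=2\gamma(H)$. The Cartesian product $G\Box H$ has vertex set $V(G)\times V(H)$, with $(g,h)\sim(g',h')$ iff ($g=g'$ and $h\sim h'$) or ($g\sim g'$ and $h=h'$). -}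

module Defs where

open import Data.Nat using (ℕ; zero; suc; _+_; _*_; _≤_)
open import Data.Fin using (Fin; toℕ; remQuot)
open import Data.Fin.Subset using (Subset; _∈_; _∉_; ∣_∣)
open import Data.Product using (Σ; _×_; _,_; ∃; proj₁; proj₂)
open import Data.Sum using (_⊎_; inj₁; inj₂)
open import Relation.Nullary using (¬_)
open import Relation.Binary.PropositionalEquality using (_≡_; refl; sym)

record Graph : Set₁ where
  field
    n      : ℕ
    Adj    : Fin n → Fin n → Set
    Adj-sym    : ∀ {u v} → Adj u v → Adj v u
    Adj-irrefl : ∀ {v} → ¬ Adj v v
open Graph public

ProdAdj : (G H : Graph) → Fin (n G) × Fin (n H) → Fin (n G) × Fin (n H) → Set
ProdAdj G H (g , h) (g' , h') = (g ≡ g' × Adj H h h') ⊎ (Adj G g g' × h ≡ h')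

ProdAdj-sym : (G H : Graph) → ∀ {x y} → ProdAdj G H x y → ProdAdj G H y x
ProdAdj-sym G H (inj₁ (e , a)) = inj₁ (sym e , Adj-sym H a)
ProdAdj-sym G H (inj₂ (a , e)) = inj₂ (Adj-sym G a , sym e)

ProdAdj-irrefl : (G H : Graph) → ∀ {x} → ¬ ProdAdj G H x x
ProdAdj-irrefl G H (inj₁ (_ , a)) = Adj-irrefl H a
ProdAdj-irrefl G H (inj₂ (a , _)) = Adj-irrefl G a

-- Cartesian product G □ H on vertex set Fin (n G * n H), identified with
-- Fin (n G) × Fin (n H) via remQuot (the inverse of Data.Fin.combine).
_□_ : Graph → Graph → Graph
G □ H = record
  { n = n G * n H
  ; Adj = λ x y → ProdAdj G H (remQuot (n H) x) (remQuot (n H) y)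
  ; Adj-sym = ProdAdj-sym G H
  ; Adj-irrefl = ProdAdj-irrefl G H
  }

IsDominating : (G : Graph) → Subset (n G) → Set
IsDominating G D = ∀ v → v ∉ D → ∃ λ u → u ∈ D × Adj G v u

IsDominationNumber : Graph → ℕ → Set
IsDominationNumber G k =
  (∃ λ D → IsDominating G D × ∣ D ∣ ≡ k) ×
  (∀ D → IsDominating G D → k ≤ ∣ D ∣)

sumFin : (m : ℕ) → (Fin m → ℕ) → ℕ
sumFin zero    f = 0
sumFin (suc m) f = f Fin.zero + sumFin m (λ i → f (Fin.suc i))
  where import Data.Fin as Fin

weight : (G : Graph) → (Fin (n G) → Fin 3) → ℕ
weight G f = sumFin (n G) (λ v → toℕ (f v))

IsRomanDominating : (G : Graph) → (Fin (n G) → Fin 3) → Set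
IsRomanDominating G f = ∀ v → toℕ (f v) ≡ 0 → ∃ λ u → Adj G v u × toℕ (f u) ≡ 2

IsRomanDominationNumber : Graph → ℕ → Set
IsRomanDominationNumber G k =
  (∃ λ f → IsRomanDominating G f × weight G f ≡ k) ×
  (∀ f → IsRomanDominating G f → k ≤ weight G f)

IsRoman : Graph → Set
IsRoman H = ∀ g r → IsDominationNumber H g → IsRomanDominationNumber H r → r ≡ 2 * g

-- Fix a minimum dominating set D of G and send each vertex x of G to some
-- centre c(x) ∈ D equal or adjacent to x.  For a Roman dominating function f
-- on G □ H and u ∈ D, add up f over the cell c⁻¹(u) in every layer h and cap
-- the result at 2, except that a layer in which no vertex of the cell is
-- dominated from inside its own H-fibre gets the label 1.  This is a Roman
-- dominating function on H, so it weighs at least γ_R(H) = 2γ(H); summing over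
-- D gives 2γ(G)γ(H) ≤ A + w(f), where A counts the uncovered pairs (u, h).
-- In each layer G × {h}, the vertices labelled 2 together with the covered
-- centres dominate G, so at most (number of 2s in the layer) centres are
-- uncovered, whence 2A ≤ w(f) and 4γ(G)γ(H) ≤ 3w(f).  Part (ii) follows from
-- γ_R ≤ 2γ.  Adjacency is not decidable, so whether a cell is covered, and the
-- existence of a minimum Roman dominating function on H, are only available
-- under double negation; this suffices because the conclusions are decidable
-- inequalities.

module Submission where

open import Defs

open import Data.Bool.Base using (Bool; true; false; _∧_; _∨_; not)
open import Data.Bool.Properties using (∨-zeroʳ)
open import Data.Fin.Base using (Fin; zero; suc; toℕ; combine; remQuot; _↑ˡ_; _↑ʳ_)
open import Data.Fin.Patterns using (0F; 1F; 2F)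
open import Data.Fin.Properties using (_≟_; remQuot-combine; combine-remQuot)
open import Data.Fin.Subset using (Subset; _∈_; _∉_; ∣_∣)
open import Data.Fin.Subset.Properties using (_∈?_)
open import Data.Nat.Base using (ℕ; zero; suc; _+_; _*_; _≤_; _<_; z≤n; s≤s)
import Data.Nat.Properties as ℕ
open import Data.Nat.Properties
  using (+-*-semiring; ≤-refl; ≤-trans; ≤-reflexive; ≤-pred; ≰⇒>; _≤?_
        ; n≤0⇒n≡0; m≤m+n; m≤n+m; +-assoc; +-comm; +-identityʳ; +-mono-≤; +-monoˡ-≤; +-cancelˡ-≤
        ; *-assoc; *-identityˡ; *-identityʳ; *-zeroʳ; *-distribˡ-+; *-monoʳ-≤; *-cancelˡ-≤)
open import Data.Nat.Solver using (module +-*-Solver)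
open import Data.Product using (∃; _×_; _,_; proj₁; proj₂)
open import Data.Sum using (_⊎_; inj₁; inj₂)
open import Data.Vec.Base using ([]; _∷_; lookup; tabulate)
open import Data.Vec.Properties using ([]=⇒lookup; lookup⇒[]=; lookup∘tabulate)
open import Function.Base using (_∘_)
open import Relation.Binary.PropositionalEquality
  using (_≡_; _≢_; refl; sym; trans; cong; cong₂; subst; subst₂; module ≡-Reasoning)
open import Relation.Nullary.Decidable using (Dec; yes; no; does; dec-true; decidable-stable; ¬¬-excluded-middle)
open import Relation.Nullary.Negation using (¬_; ¬¬-map; contradiction)

open import Algebra.Properties.Semiring.Sum +-*-semiring
  using (sum; sum-syntax; sum-cong-≗; sum-replicate-zero; ∑-distrib-+; ∑-comm; *-distribˡ-sum; *-distribʳ-sum)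

𝟙 : Bool → ℕ
𝟙 true  = 1
𝟙 false = 0

𝟙-∨ : ∀ a b → 𝟙 (a ∨ b) ≤ 𝟙 a + 𝟙 b
𝟙-∨ true  b = s≤s z≤n
𝟙-∨ false b = ≤-refl

𝟙-split : ∀ a b → 𝟙 a ≡ 𝟙 (a ∧ b) + 𝟙 (a ∧ not b)
𝟙-split true  true  = refl
𝟙-split true  false = refl
𝟙-split false b     = refl

sumFin≡sum : ∀ m (f : Fin m → ℕ) → sumFin m f ≡ sum f
sumFin≡sum zero    f = refl
sumFin≡sum (suc m) f = cong (f zero +_) (sumFin≡sum m (f ∘ suc))

sum-mono-≤ : ∀ {m} {f g : Fin m → ℕ} → (∀ i → f i ≤ g i) → sum f ≤ sum g
sum-mono-≤ {zero}  f≤g = z≤n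
sum-mono-≤ {suc m} f≤g = +-mono-≤ (f≤g zero) (sum-mono-≤ (f≤g ∘ suc))

term≤sum : ∀ {m} (f : Fin m → ℕ) i → f i ≤ sum f
term≤sum f zero    = m≤m+n _ _
term≤sum f (suc i) = ≤-trans (term≤sum (f ∘ suc) i) (m≤n+m _ _)

sum-↑ : ∀ m {k} (f : Fin (m + k) → ℕ) → sum f ≡ sum (f ∘ (_↑ˡ k)) + sum (f ∘ (m ↑ʳ_))
sum-↑ zero    f = refl
sum-↑ (suc m) f = trans (cong (f zero +_) (sum-↑ m (f ∘ suc))) (sym (+-assoc (f zero) _ _))

sum-combine : ∀ m {k} (f : Fin (m * k) → ℕ) →
  sum f ≡ ∑[ i < m ] ∑[ j < k ] f (combine i j)
sum-combine zero    f = refl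
sum-combine (suc m) {k} f =
  trans (sum-↑ k f) (cong (sum (f ∘ (_↑ˡ (m * k))) +_) (sum-combine m (f ∘ (k ↑ʳ_))))

∑-δ : ∀ {m} (i : Fin m) → ∑[ j < m ] 𝟙 (does (i ≟ j)) ≡ 1
∑-δ {suc m} zero = cong suc (sum-replicate-zero m)
∑-δ (suc i) = ∑-δ i

∣p∣≡∑𝟙 : ∀ {m} (p : Subset m) → ∣ p ∣ ≡ ∑[ i < m ] 𝟙 (lookup p i)
∣p∣≡∑𝟙 []          = refl
∣p∣≡∑𝟙 (true  ∷ p) = cong suc (∣p∣≡∑𝟙 p)
∣p∣≡∑𝟙 (false ∷ p) = ∣p∣≡∑𝟙 p

fibreSum : ∀ {m k} → (Fin m → Fin k) → (Fin m → ℕ) → Fin k → ℕ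
fibreSum {m} π a u = ∑[ x < m ] (𝟙 (does (π x ≟ u)) * a x)

≤-fibreSum : ∀ {m k} (π : Fin m → Fin k) (a : Fin m → ℕ) x → a x ≤ fibreSum π a (π x)
≤-fibreSum π a x = ≤-trans (≤-reflexive (sym δ-diag)) (term≤sum (λ y → 𝟙 (does (π y ≟ π x)) * a y) x)
  where
  δ-diag : 𝟙 (does (π x ≟ π x)) * a x ≡ a x
  δ-diag = trans (cong (λ d → 𝟙 d * a x) (dec-true (π x ≟ π x) refl)) (+-identityʳ (a x))

∑-fibreSum : ∀ {m k} (π : Fin m → Fin k) (a : Fin m → ℕ) → ∑[ u < k ] fibreSum π a u ≡ sum a
∑-fibreSum {m} {k} π a = begin
  ∑[ u < k ] ∑[ x < m ] (𝟙 (does (π x ≟ u)) * a x)   ≡⟨ ∑-comm {k} {m} (λ u x → 𝟙 (does (π x ≟ u)) * a x) ⟩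
  ∑[ x < m ] ∑[ u < k ] (𝟙 (does (π x ≟ u)) * a x)   ≡⟨ sum-cong-≗ (λ x → sym (*-distribʳ-sum (a x) (λ u → 𝟙 (does (π x ≟ u))))) ⟩
  ∑[ x < m ] (∑[ u < k ] 𝟙 (does (π x ≟ u)) * a x)   ≡⟨ sum-cong-≗ (λ x → trans (cong (_* a x) (∑-δ (π x))) (*-identityˡ (a x))) ⟩
  sum a                                              ∎
  where open ≡-Reasoning

¬¬-Π : ∀ {m} {P : Fin m → Set} → (∀ i → ¬ ¬ P i) → ¬ ¬ (∀ i → P i)
¬¬-Π {zero}  ¬¬P ¬Π = ¬Π λ ()
¬¬-Π {suc m} ¬¬P ¬Π = ¬¬P zero λ P₀ → ¬¬-Π (¬¬P ∘ suc) λ Pₛ → ¬Π λ { zero → P₀ ; (suc i) → Pₛ i }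

¬¬-decide² : ∀ {m l} (P : Fin m → Fin l → Set) → ¬ ¬ (∀ i j → Dec (P i j))
¬¬-decide² P = ¬¬-Π λ i → ¬¬-Π λ j → ¬¬-excluded-middle

¬¬-least : (P : ℕ → Set) → ∀ {m} → P m → ¬ ¬ (∃ λ k → P k × (∀ j → P j → k ≤ j))
¬¬-least P {m} Pm ¬least = nothingBelow (suc m) m ≤-refl Pm
  where
  nothingBelow : ∀ b i → i < b → ¬ P i
  nothingBelow (suc b) i i<b Pi = ¬least (i , Pi , λ j Pj →
    decidable-stable (i ≤? j) λ i≰j → nothingBelow b j (≤-trans (≰⇒> i≰j) (≤-pred i<b)) Pj)

dominator : ∀ {X D} → IsDominating X D → ∀ x → ∃ λ u → u ∈ D × (x ≡ u ⊎ Adj X x u)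
dominator {D = D} D-dom x with x ∈? D
... | yes x∈D = x , x∈D , inj₁ refl
... | no  x∉D = let u , u∈D , x~u = D-dom x x∉D in u , u∈D , inj₂ x~u

2·𝟙 : Bool → Fin 3
2·𝟙 true  = 2F
2·𝟙 false = 0F

twoOn : ∀ {m} → Subset m → Fin m → Fin 3
twoOn D = 2·𝟙 ∘ lookup D

twoOn-romanDominating : ∀ {X D} → IsDominating X D → IsRomanDominating X (twoOn D)
twoOn-romanDominating {X} {D} D-dom v Dv≡0 with lookup D v in eq
... | false = let u , u∈D , v~u = D-dom v v∉D in u , v~u , cong (toℕ ∘ 2·𝟙) ([]=⇒lookup u∈D)
  where
  v∉D : v ∉ D
  v∉D v∈D with () ← trans (sym ([]=⇒lookup v∈D)) eq

weight-twoOn : ∀ X (D : Subset (n X)) → weight X (twoOn D) ≡ 2 * ∣ D ∣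
weight-twoOn X D = begin
  weight X (twoOn D)                      ≡⟨ sumFin≡sum (n X) _ ⟩
  ∑[ v < n X ] toℕ (2·𝟙 (lookup D v))      ≡⟨ sum-cong-≗ (λ v → toℕ-2·𝟙 (lookup D v)) ⟩
  ∑[ v < n X ] (2 * 𝟙 (lookup D v))        ≡⟨ *-distribˡ-sum 2 (𝟙 ∘ lookup D) ⟨
  2 * ∑[ v < n X ] 𝟙 (lookup D v)          ≡⟨ cong (2 *_) (∣p∣≡∑𝟙 D) ⟨
  2 * ∣ D ∣                                ∎
  where
  open ≡-Reasoning
  toℕ-2·𝟙 : ∀ b → toℕ (2·𝟙 b) ≡ 2 * 𝟙 b
  toℕ-2·𝟙 true  = refl
  toℕ-2·𝟙 false = refl

romanDomination≤2*domination : ∀ {X k r} → IsDominationNumber X k → IsRomanDominationNumber X r → r ≤ 2 * k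
romanDomination≤2*domination {X} {r = r} ((D , D-dom , ∣D∣≡k) , _) (_ , r-min) =
  subst (r ≤_) (trans (weight-twoOn X D) (cong (2 *_) ∣D∣≡k)) (r-min (twoOn D) (twoOn-romanDominating {X} D-dom))

roman⇒weight≥2γ : ∀ {H k} → IsRoman H → IsDominationNumber H k →
  ¬ ¬ (∀ g → IsRomanDominating H g → 2 * k ≤ weight H g)
roman⇒weight≥2γ {H} {k} roman γH@((D , D-dom , ∣D∣≡k) , _) =
  ¬¬-map bound (¬¬-least Attained (twoOn D , twoOn-romanDominating {H} D-dom , trans (weight-twoOn H D) (cong (2 *_) ∣D∣≡k)))
  where
  Attained : ℕ → Set
  Attained w = ∃ λ g → IsRomanDominating H g × weight H g ≡ w
  bound : (∃ λ r → Attained r × (∀ j → Attained j → r ≤ j)) → ∀ g → IsRomanDominating H g → 2 * k ≤ weight H g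
  bound (r , attained , least) g g-rdf =
    subst (_≤ weight H g) (roman k r γH (attained , λ g′ g′-rdf → least _ (g′ , g′-rdf , refl))) (least _ (g , g-rdf , refl))

cap₂ : ℕ → Fin 3
cap₂ 0               = 0F
cap₂ 1               = 1F
cap₂ (suc (suc _))   = 2F

toℕ-cap₂≤ : ∀ s → toℕ (cap₂ s) ≤ s
toℕ-cap₂≤ 0             = z≤n
toℕ-cap₂≤ 1             = ≤-refl
toℕ-cap₂≤ (suc (suc s)) = s≤s (s≤s z≤n)

toℕ-cap₂≡0 : ∀ s → toℕ (cap₂ s) ≡ 0 → s ≡ 0
toℕ-cap₂≡0 0             _  = refl
toℕ-cap₂≡0 1             ()
toℕ-cap₂≡0 (suc (suc s)) ()

toℕ-cap₂-≥2 : ∀ {s} → 2 ≤ s → toℕ (cap₂ s) ≡ 2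
toℕ-cap₂-≥2 (s≤s (s≤s _)) = refl

is2 : ℕ → Bool
is2 s = does (s ℕ.≟ 2)

2*𝟙-is2≤ : ∀ s → 2 * 𝟙 (is2 s) ≤ s
2*𝟙-is2≤ 0                   = z≤n
2*𝟙-is2≤ 1                   = z≤n
2*𝟙-is2≤ 2                   = ≤-refl
2*𝟙-is2≤ (suc (suc (suc s))) = z≤n

∈-tabulate : ∀ {m} {p : Fin m → Bool} {x} → p x ≡ true → x ∈ tabulate p
∈-tabulate {p = p} {x} px = lookup⇒[]= x (tabulate p) (trans (lookup∘tabulate p x) px)

module ProductBound
  (G H : Graph)
  {D : Subset (n G)} (D-dom : IsDominating G D) (D-min : ∀ D′ → IsDominating G D′ → ∣ D ∣ ≤ ∣ D′ ∣)
  {k : ℕ} (H-bound : ∀ g → IsRomanDominating H g → 2 * k ≤ weight H g)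
  {f : Fin (n G * n H) → Fin 3} (f-rdf : IsRomanDominating (G □ H) f)
  where

  F : Fin (n G) → Fin (n H) → ℕ
  F x h = toℕ (f (combine x h))

  total : ℕ
  total = ∑[ x < n G ] ∑[ h < n H ] F x h

  weight≡total : weight (G □ H) f ≡ total
  weight≡total = trans (sumFin≡sum (n G * n H) _) (sum-combine (n G) _)

  F-roman : ∀ x h → F x h ≡ 0 →
    (∃ λ h′ → Adj H h h′ × F x h′ ≡ 2) ⊎ (∃ λ x′ → Adj G x x′ × F x′ h ≡ 2)
  F-roman x h Fxh≡0 with f-rdf (combine x h) Fxh≡0
  ... | v , xh~v , fv≡2 = neighbour (remQuot (n H) v)
    (subst (λ p → ProdAdj G H p (remQuot (n H) v)) (remQuot-combine x h) xh~v)
    (subst (λ w → toℕ (f w) ≡ 2) (sym (combine-remQuot {n G} (n H) v)) fv≡2)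
    where
    neighbour : ∀ p → ProdAdj G H (x , h) p → F (proj₁ p) (proj₂ p) ≡ 2 →
      (∃ λ h′ → Adj H h h′ × F x h′ ≡ 2) ⊎ (∃ λ x′ → Adj G x x′ × F x′ h ≡ 2)
    neighbour (_  , h′) (inj₁ (refl , h~h′)) F≡2 = inj₁ (h′ , h~h′ , F≡2)
    neighbour (x′ , _)  (inj₂ (x~x′ , refl)) F≡2 = inj₂ (x′ , x~x′ , F≡2)

  centre : Fin (n G) → Fin (n G)
  centre x = proj₁ (dominator {G} D-dom x)

  centre∈D : ∀ x → centre x ∈ D
  centre∈D x = proj₁ (proj₂ (dominator {G} D-dom x))

  centre-near : ∀ x → x ≡ centre x ⊎ Adj G x (centre x)
  centre-near x = proj₂ (proj₂ (dominator {G} D-dom x))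

  cellSum : Fin (n G) → Fin (n H) → ℕ
  cellSum u h = fibreSum centre (λ x → F x h) u

  ≤-cellSum : ∀ {x u h} → centre x ≡ u → F x h ≤ cellSum u h
  ≤-cellSum {x} {h = h} refl = ≤-fibreSum centre (λ y → F y h) x

  VerticallyDominated : Fin (n G) → Fin (n H) → Set
  VerticallyDominated x h = F x h ≢ 0 ⊎ ∃ λ h′ → Adj H h h′ × F x h′ ≡ 2

  Covered : Fin (n G) → Fin (n H) → Set
  Covered u h = ∃ λ x → centre x ≡ u × VerticallyDominated x h

  module Decided (covered? : ∀ u h → Dec (Covered u h)) where

    covered : Fin (n G) → Fin (n H) → Bool
    covered u h = does (covered? u h)

    shadow : Fin (n G) → Fin (n H) → Fin 3
    shadow u h with covered? u h
    ... | yes _ = cap₂ (cellSum u h)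
    ... | no  _ = 1F

    shadow-2 : ∀ {x u h} → centre x ≡ u → F x h ≡ 2 → toℕ (shadow u h) ≡ 2
    shadow-2 {x} {u} {h} cx≡u Fxh≡2 with covered? u h
    ... | yes _ = toℕ-cap₂-≥2 (subst (_≤ cellSum u h) Fxh≡2 (≤-cellSum cx≡u))
    ... | no ¬c = contradiction (x , cx≡u , inj₁ λ Fxh≡0 → contradiction (trans (sym Fxh≡2) Fxh≡0) λ ()) ¬c

    shadow-romanDominating : ∀ u → IsRomanDominating H (shadow u)
    shadow-romanDominating u h sh≡0 with covered? u h
    shadow-romanDominating u h () | no _
    ... | yes (x , cx≡u , inj₁ Fxh≢0) =
      contradiction (n≤0⇒n≡0 (≤-trans (≤-cellSum cx≡u) (≤-reflexive (toℕ-cap₂≡0 _ sh≡0)))) Fxh≢0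
    ... | yes (x , cx≡u , inj₂ (h′ , h~h′ , Fxh′≡2)) = h′ , h~h′ , shadow-2 cx≡u Fxh′≡2

    shadow≤ : ∀ u h → toℕ (shadow u h) ≤ 𝟙 (not (covered u h)) + cellSum u h
    shadow≤ u h with covered? u h
    ... | yes _ = toℕ-cap₂≤ (cellSum u h)
    ... | no  _ = s≤s z≤n

    column-bound : ∀ u → 2 * k ≤ ∑[ h < n H ] 𝟙 (not (covered u h)) + ∑[ h < n H ] cellSum u h
    column-bound u = begin
      2 * k                                                        ≤⟨ H-bound (shadow u) (shadow-romanDominating u) ⟩
      weight H (shadow u)                                          ≡⟨ sumFin≡sum (n H) _ ⟩
      ∑[ h < n H ] toℕ (shadow u h)                                ≤⟨ sum-mono-≤ (shadow≤ u) ⟩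
      ∑[ h < n H ] (𝟙 (not (covered u h)) + cellSum u h)          ≡⟨ ∑-distrib-+ (λ h → 𝟙 (not (covered u h))) (cellSum u) ⟩
      ∑[ h < n H ] 𝟙 (not (covered u h)) + ∑[ h < n H ] cellSum u h ∎
      where open ℕ.≤-Reasoning

    uncovered : Fin (n G) → Fin (n H) → ℕ
    uncovered u h = 𝟙 (lookup D u ∧ not (covered u h))

    column-bound-D : ∀ u → 2 * k * 𝟙 (lookup D u) ≤ ∑[ h < n H ] uncovered u h + ∑[ h < n H ] cellSum u h
    column-bound-D u = restrict (lookup D u) (column-bound u)
      where
      restrict : ∀ b {c} → 2 * k ≤ ∑[ h < n H ] 𝟙 (not (covered u h)) + c →
        2 * k * 𝟙 b ≤ ∑[ h < n H ] 𝟙 (b ∧ not (covered u h)) + c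
      restrict true  2k≤ = ≤-trans (≤-reflexive (*-identityʳ (2 * k))) 2k≤
      restrict false _   = ≤-trans (≤-reflexive (*-zeroʳ (2 * k))) z≤n

    rowDominator : Fin (n H) → Subset (n G)
    rowDominator h = tabulate λ x → is2 (F x h) ∨ (lookup D x ∧ covered x h)

    rowDominator-dominating : ∀ h → IsDominating G (rowDominator h)
    rowDominator-dominating h x x∉R with covered? (centre x) h
    ... | yes c = viaCentre (centre-near x)
      where
      centre∈R : centre x ∈ rowDominator h
      centre∈R = ∈-tabulate (trans
        (cong (is2 (F (centre x) h) ∨_) (cong₂ _∧_ ([]=⇒lookup (centre∈D x)) (dec-true (covered? (centre x) h) c)))
        (∨-zeroʳ _))
      viaCentre : x ≡ centre x ⊎ Adj G x (centre x) → ∃ λ y → y ∈ rowDominator h × Adj G x y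
      viaCentre (inj₁ x≡cx) = contradiction (subst (_∈ rowDominator h) (sym x≡cx) centre∈R) x∉R
      viaCentre (inj₂ x~cx) = centre x , centre∈R , x~cx
    ... | no ¬c with F x h ℕ.≟ 0
    ...   | no Fxh≢0 = contradiction (x , refl , inj₁ Fxh≢0) ¬c
    ...   | yes Fxh≡0 with F-roman x h Fxh≡0
    ...     | inj₁ vertical = contradiction (x , refl , inj₂ vertical) ¬c
    ...     | inj₂ (x′ , x~x′ , Fx′h≡2) = x′ , ∈-tabulate (cong (λ s → is2 s ∨ _) Fx′h≡2) , x~x′

    row-bound : ∀ h → ∑[ u < n G ] uncovered u h ≤ ∑[ x < n G ] 𝟙 (is2 (F x h))
    row-bound h = +-cancelˡ-≤ C _ _ (begin
      C + ∑[ u < n G ] uncovered u h                                ≡⟨ ∑-distrib-+ coveredD (λ u → uncovered u h) ⟨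
      ∑[ u < n G ] (coveredD u + uncovered u h)                     ≡⟨ sum-cong-≗ (λ u → 𝟙-split (lookup D u) (covered u h)) ⟨
      ∑[ u < n G ] 𝟙 (lookup D u)                                   ≡⟨ ∣p∣≡∑𝟙 D ⟨
      ∣ D ∣                                                         ≤⟨ D-min (rowDominator h) (rowDominator-dominating h) ⟩
      ∣ rowDominator h ∣                                            ≡⟨ ∣p∣≡∑𝟙 (rowDominator h) ⟩
      ∑[ x < n G ] 𝟙 (lookup (rowDominator h) x)                    ≡⟨ sum-cong-≗ (λ x → cong 𝟙 (lookup∘tabulate (λ y → is2 (F y h) ∨ (lookup D y ∧ covered y h)) x)) ⟩
      ∑[ x < n G ] 𝟙 (is2 (F x h) ∨ (lookup D x ∧ covered x h))      ≤⟨ sum-mono-≤ (λ x → 𝟙-∨ (is2 (F x h)) _) ⟩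
      ∑[ x < n G ] (𝟙 (is2 (F x h)) + coveredD x)                   ≡⟨ ∑-distrib-+ (λ x → 𝟙 (is2 (F x h))) coveredD ⟩
      ∑[ x < n G ] 𝟙 (is2 (F x h)) + C                              ≡⟨ +-comm _ C ⟩
      C + ∑[ x < n G ] 𝟙 (is2 (F x h))                              ∎)
      where
      open ℕ.≤-Reasoning
      coveredD : Fin (n G) → ℕ
      coveredD u = 𝟙 (lookup D u ∧ covered u h)
      C : ℕ
      C = sum coveredD

    deficit : ℕ
    deficit = ∑[ u < n G ] ∑[ h < n H ] uncovered u h

    cells≡total : ∑[ u < n G ] ∑[ h < n H ] cellSum u h ≡ total
    cells≡total = begin
      ∑[ u < n G ] ∑[ h < n H ] cellSum u h  ≡⟨ ∑-comm cellSum ⟩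
      ∑[ h < n H ] ∑[ u < n G ] cellSum u h  ≡⟨ sum-cong-≗ (λ h → ∑-fibreSum centre (λ x → F x h)) ⟩
      ∑[ h < n H ] ∑[ x < n G ] F x h        ≡⟨ ∑-comm F ⟨
      total                                  ∎
      where open ≡-Reasoning

    columns-bound : 2 * k * ∣ D ∣ ≤ deficit + total
    columns-bound = begin
      2 * k * ∣ D ∣                                                        ≡⟨ cong (2 * k *_) (∣p∣≡∑𝟙 D) ⟩
      2 * k * ∑[ u < n G ] 𝟙 (lookup D u)                                  ≡⟨ *-distribˡ-sum (2 * k) (𝟙 ∘ lookup D) ⟩
      ∑[ u < n G ] (2 * k * 𝟙 (lookup D u))                                ≤⟨ sum-mono-≤ column-bound-D ⟩
      ∑[ u < n G ] (∑[ h < n H ] uncovered u h + ∑[ h < n H ] cellSum u h) ≡⟨ ∑-distrib-+ (λ u → ∑[ h < n H ] uncovered u h) (λ u → ∑[ h < n H ] cellSum u h) ⟩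
      deficit + ∑[ u < n G ] ∑[ h < n H ] cellSum u h                      ≡⟨ cong (deficit +_) cells≡total ⟩
      deficit + total                                                      ∎
      where open ℕ.≤-Reasoning

    rows-bound : 2 * deficit ≤ total
    rows-bound = begin
      2 * deficit                                       ≡⟨ cong (2 *_) (∑-comm uncovered) ⟩
      2 * ∑[ h < n H ] ∑[ u < n G ] uncovered u h       ≤⟨ *-monoʳ-≤ 2 (sum-mono-≤ row-bound) ⟩
      2 * ∑[ h < n H ] ∑[ x < n G ] 𝟙 (is2 (F x h))     ≡⟨ *-distribˡ-sum 2 (λ h → ∑[ x < n G ] 𝟙 (is2 (F x h))) ⟩
      ∑[ h < n H ] (2 * ∑[ x < n G ] 𝟙 (is2 (F x h)))   ≡⟨ sum-cong-≗ (λ h → *-distribˡ-sum 2 (λ x → 𝟙 (is2 (F x h)))) ⟩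
      ∑[ h < n H ] ∑[ x < n G ] (2 * 𝟙 (is2 (F x h)))   ≤⟨ sum-mono-≤ (λ h → sum-mono-≤ (λ x → 2*𝟙-is2≤ (F x h))) ⟩
      ∑[ h < n H ] ∑[ x < n G ] F x h                   ≡⟨ ∑-comm F ⟨
      total                                             ∎
      where open ℕ.≤-Reasoning

    bound : 4 * (∣ D ∣ * k) ≤ 3 * weight (G □ H) f
    bound = begin
      4 * (∣ D ∣ * k)          ≡⟨ reorder ∣ D ∣ k ⟩
      2 * (2 * k * ∣ D ∣)      ≤⟨ *-monoʳ-≤ 2 columns-bound ⟩
      2 * (deficit + total)    ≡⟨ *-distribˡ-+ 2 deficit total ⟩
      2 * deficit + 2 * total  ≤⟨ +-monoˡ-≤ (2 * total) rows-bound ⟩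
      total + 2 * total        ≡⟨⟩
      3 * total                ≡⟨ cong (3 *_) weight≡total ⟨
      3 * weight (G □ H) f     ∎
      where
      open ℕ.≤-Reasoning
      open +-*-Solver
      reorder : ∀ a b → 4 * (a * b) ≡ 2 * (2 * b * a)
      reorder = solve 2 (λ a b → con 4 :* (a :* b) := con 2 :* (con 2 :* b :* a)) refl

□-romanDomination-lowerBound : ∀ G H {D} → IsDominating G D → (∀ D′ → IsDominating G D′ → ∣ D ∣ ≤ ∣ D′ ∣) →
  ∀ {k} → (∀ g → IsRomanDominating H g → 2 * k ≤ weight H g) →
  ∀ {f} → IsRomanDominating (G □ H) f → 4 * (∣ D ∣ * k) ≤ 3 * weight (G □ H) f
□-romanDomination-lowerBound G H {D} D-dom D-min {k} H-bound {f} f-rdf =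
  decidable-stable (_ ≤? _) (¬¬-map Decided.bound (¬¬-decide² Covered))
  where open ProductBound G H {D} D-dom D-min {k} H-bound {f} f-rdf

corollary6 : (G H : Graph) → IsRoman H →
    ∀ gG gH rGH gGH →
    IsDominationNumber G gG → IsDominationNumber H gH →
    IsRomanDominationNumber (G □ H) rGH → IsDominationNumber (G □ H) gGH →
    (4 * (gG * gH) ≤ 3 * rGH) × (2 * (gG * gH) ≤ 3 * gGH)
corollary6 G H roman gG gH rGH gGH ((D , D-dom , ∣D∣≡gG) , γG-min) γH γR@((f , f-rdf , wf≡rGH) , _) γGH =
  part-i , part-ii
  where
  D-min : ∀ D′ → IsDominating G D′ → ∣ D ∣ ≤ ∣ D′ ∣
  D-min D′ D′-dom = subst (_≤ ∣ D′ ∣) (sym ∣D∣≡gG) (γG-min D′ D′-dom)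

  part-i : 4 * (gG * gH) ≤ 3 * rGH
  part-i = decidable-stable (_ ≤? _) (¬¬-map
    (λ H-bound → subst₂ (λ d w → 4 * (d * gH) ≤ 3 * w) ∣D∣≡gG wf≡rGH
                   (□-romanDomination-lowerBound G H D-dom D-min H-bound f-rdf))
    (roman⇒weight≥2γ {H} roman γH))

  part-ii : 2 * (gG * gH) ≤ 3 * gGH
  part-ii = *-cancelˡ-≤ 2 (begin
    2 * (2 * (gG * gH))  ≡⟨ *-assoc 2 2 (gG * gH) ⟨
    4 * (gG * gH)        ≤⟨ part-i ⟩
    3 * rGH              ≤⟨ *-monoʳ-≤ 3 (romanDomination≤2*domination {G □ H} γGH γR) ⟩
    3 * (2 * gGH)        ≡⟨ *-assoc 3 2 gGH ⟨
    6 * gGH              ≡⟨ *-assoc 2 3 gGH ⟩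
    2 * (3 * gGH)        ∎)
    where open ℕ.≤-Reasoning
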